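{- For integers $a,b\ge0$, $0\le k\le a$ and $0\le \ell\le b$, \[ \left(x^ky^{a-k}\right)\bullet\left(x^\ell y^{b-\ell}\right)=\sum_i\binom{a-k+\ell}{i-k}\binom{b-\ell+k}{i-\ell}\,x^iy^{a+b-i}. \]
   Context: Let $\mathbb{R}_d[x]$ be the space of univariate real polynomials of degree at most $d$ and $\mathbb{R}[x,y]_d$ the space of real homogeneous bivariate polynomials of degree $d$. Let $T_d:\mathbb{R}_d[x]\to\mathbb{R}[x,y]_d$ be the linear bijection sending $\binom{x+d-i}{d}\mapsto x^iy^{d-i}$ for $0\le i\le d$. For $p\in\mathbb{R}[x,y]_a$, $q\in\mathbb{R}[x,y]_b$ define $p\bullet q=T_{a+b}\big(T_a^{ -1}(p)\cdot T_b^{ -1}(q)\big)\in\mathbb{R}[x,y]_{a+b}$. Binomial coefficients $\binom{n}{j}$ are zero for $j<0$ or $j>n$. -}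

module Defs where

open import Data.Nat using (ℕ; zero; suc; _∸_; _<ᵇ_; _+_)
open import Data.Nat.Combinatorics using (_C_)
open import Data.Bool using (if_then_else_)
open import Data.Fin using (Fin; toℕ)
import Data.Fin as F
open import Data.Integer using (+_)
open import Data.Rational using (ℚ; _/_) renaming (_+_ to _+ℚ_; _*_ to _*ℚ_; _-_ to _-ℚ_)
import Data.Rational as Q
open import Relation.Binary.PropositionalEquality using (_≡_)

ℕ→ℚ : ℕ → ℚ
ℕ→ℚ n = (+ n) / 1

sumF : ∀ {n} → (Fin n → ℚ) → ℚ
sumF {zero} f = Q.0ℚ
sumF {suc n} f = f F.zero +ℚ sumF (λ i → f (F.suc i))

gbinom : ℚ → ℕ → ℚ
gbinom t zero = Q.1ℚ
gbinom t (suc d) = (gbinom t d *ℚ (t -ℚ ℕ→ℚ d)) *ℚ ((+ 1) / suc d)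

-- binomial coefficient with the convention binom n j = 0 for j < 0 or j > n,
-- here j = i - k (an integer): binomOff n i k = binom(n, i - k)
binomOff : ℕ → ℕ → ℕ → ℕ
binomOff n i k = if i <ᵇ k then 0 else n C (i ∸ k)

-- ℝ[x,y]_d : homogeneous bivariate polynomial of degree d, given by its
-- coefficients; h i is the coefficient of x^i y^(d-i)
Hom : ℕ → Set
Hom d = Fin (suc d) → ℚ

monomial : (d k : ℕ) → Hom d
monomial d k i = if (toℕ i Data.Nat.≡ᵇ k) then Q.1ℚ else Q.0ℚ
  where import Data.Nat

-- T_d^{-1} : ℝ[x,y]_d → ℝ_d[x], sending x^i y^(d-i) ↦ binom(x+d-i, d),
-- with the result represented as a polynomial function of x
Tinv : (d : ℕ) → Hom d → ℚ → ℚ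
Tinv d h x = sumF (λ i → h i *ℚ gbinom ((x +ℚ ℕ→ℚ d) -ℚ ℕ→ℚ (toℕ i)) d)

-- p • q ≡ r  :⇔  r = T_{a+b}(T_a^{-1}(p) · T_b^{-1}(q))
--            ⇔  T_{a+b}^{-1}(r) = T_a^{-1}(p) · T_b^{-1}(q)   (T_{a+b} bijective)
-- equality of polynomials of degree ≤ a+b checked as functions on ℚ
BulletEq : (a b : ℕ) → Hom a → Hom b → Hom (a + b) → Set
BulletEq a b p q r = ∀ (x : ℚ) → Tinv (a + b) r x ≡ (Tinv a p x *ℚ Tinv b q x)

-- Write A = a − k, B = b − l and H N i = binom(x + N − i, N), so that T_N⁻¹(x^i y^(N−i)) = H N i.
-- Applying T_(a+b)⁻¹, the claim becomes the polynomial identity in x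
--   binom(x + A, A + k) · binom(x + B, B + l) = Σᵢ binom(A + l, i − k) · binom(B + k, i − l) · H (a + b) i.
-- Fix A and k and induct on B and l. For B = l = 0 only the term i = k survives.
-- Raising l (at B = 0) multiplies the left side by (x − l)/(l + 1); on the right,
-- (x − l) · H N i = (i − l) · H (N + 1) i + (N + 1 + l − i) · H (N + 1) (i + 1), and the absorption rule
-- j · binom(n, j) = (n + 1 − j) · binom(n, j − 1), applied to both binomial factors of the coefficient,
-- shows that the new coefficients are l + 1 times the expected ones.
-- Raising B applies Pascal's rule to binom(x + B + 1, ·) on the left; on the right it uses
-- H N i = H (N + 1) i − H (N + 1) (i + 1) and Pascal's rule for the coefficients.

module Submission where

open import Defs
open import Algebra.Bundles using (CommutativeRing)
open import Data.Bool using (true; false; if_then_else_)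
open import Data.Bool.Properties using (T-≡)
open import Data.Fin as Fin using (Fin; toℕ)
open import Data.Fin.Properties using (toℕ-inject₁; toℕ-fromℕ)
import Data.Integer as ℤ
import Data.Integer.Properties as ℤ
open import Data.List using ([]; _∷_)
open import Data.Nat using (ℕ; zero; suc; _+_; _*_; _∸_; _<_; _≤_; s≤s; _≡ᵇ_)
import Data.Nat.Properties as ℕ
import Data.Nat.Tactic.RingSolver as ℕ-Solver
open import Data.Nat.Combinatorics using (_C_; nCn≡1; k>n⇒nCk≡0; nCk+nC[k+1]≡[n+1]C[k+1])
open import Data.Nat.Coprimality using (1-coprimeTo)
import Data.Nat.Coprimality as Coprime
open import Data.Rational using (ℚ; mkℚ; _/_; 0ℚ; 1ℚ; -_)
  renaming (_+_ to _+ℚ_; _*_ to _*ℚ_; _-_ to _-ℚ_)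
open import Data.Rational.Properties
open import Data.Rational.Solver using (module +-*-Solver)
open import Function using (_∘_; Equivalence)
open import Relation.Binary.Definitions using (tri<; tri≈; tri>)
open import Relation.Binary.PropositionalEquality
open import Relation.Nullary using (contradiction)

open import Algebra.Properties.Semiring.Mult (CommutativeRing.semiring +-*-commutativeRing)
  using (_×_; ×-homo-+; ×1-homo-*)
open import Algebra.Properties.Semiring.Sum (CommutativeRing.semiring +-*-commutativeRing)
  using (sum; sum-cong-≗; sum-init-last; sum-replicate-zero; ∑-distrib-+; *-distribʳ-sum)
open +-*-Solver
open ≡-Reasoning

ℕ→ℚ≡mkℚ : ∀ n → ℕ→ℚ n ≡ mkℚ (ℤ.+ n) 0 (Coprime.sym (1-coprimeTo n))
ℕ→ℚ≡mkℚ n = ↥p/↧p≡p (mkℚ (ℤ.+ n) 0 _)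

ℕ→ℚ-suc : ∀ n → ℕ→ℚ (suc n) ≡ 1ℚ +ℚ ℕ→ℚ n
ℕ→ℚ-suc n rewrite ℕ→ℚ≡mkℚ n = cong (λ z → (ℤ.+ 1 ℤ.+ z) / 1) (sym (ℤ.*-identityʳ (ℤ.+ n)))

ℕ→ℚ≡×1ℚ : ∀ n → ℕ→ℚ n ≡ n × 1ℚ
ℕ→ℚ≡×1ℚ zero    = refl
ℕ→ℚ≡×1ℚ (suc n) = trans (ℕ→ℚ-suc n) (cong (1ℚ +ℚ_) (ℕ→ℚ≡×1ℚ n))

ℕ→ℚ-+ : ∀ m n → ℕ→ℚ (m + n) ≡ ℕ→ℚ m +ℚ ℕ→ℚ n
ℕ→ℚ-+ m n rewrite ℕ→ℚ≡×1ℚ (m + n) | ℕ→ℚ≡×1ℚ m | ℕ→ℚ≡×1ℚ n = ×-homo-+ 1ℚ m n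

ℕ→ℚ-* : ∀ m n → ℕ→ℚ (m * n) ≡ ℕ→ℚ m *ℚ ℕ→ℚ n
ℕ→ℚ-* m n rewrite ℕ→ℚ≡×1ℚ (m * n) | ℕ→ℚ≡×1ℚ m | ℕ→ℚ≡×1ℚ n = ×1-homo-* m n

t+[1+n]≡t+n+1 : ∀ t n → t +ℚ ℕ→ℚ (suc n) ≡ t +ℚ ℕ→ℚ n +ℚ 1ℚ
t+[1+n]≡t+n+1 t n rewrite ℕ→ℚ-suc n =
  solve 2 (λ t n → t :+ (con 1ℚ :+ n) := t :+ n :+ con 1ℚ) refl t (ℕ→ℚ n)

t+1-[1+n]≡t-n : ∀ t n → t +ℚ 1ℚ -ℚ ℕ→ℚ (suc n) ≡ t -ℚ ℕ→ℚ n
t+1-[1+n]≡t-n t n rewrite ℕ→ℚ-suc n =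
  solve 2 (λ t n → t :+ con 1ℚ :- (con 1ℚ :+ n) := t :- n) refl t (ℕ→ℚ n)

[1+m]-[1+n]≡m-n : ∀ m n → ℕ→ℚ (suc m) -ℚ ℕ→ℚ (suc n) ≡ ℕ→ℚ m -ℚ ℕ→ℚ n
[1+m]-[1+n]≡m-n m n rewrite ℕ→ℚ-suc m | ℕ→ℚ-suc n =
  solve 2 (λ m n → (con 1ℚ :+ m) :- (con 1ℚ :+ n) := m :- n) refl (ℕ→ℚ m) (ℕ→ℚ n)

t+[1+m]-[1+n]≡t+m-n : ∀ t m n → t +ℚ ℕ→ℚ (suc m) -ℚ ℕ→ℚ (suc n) ≡ t +ℚ ℕ→ℚ m -ℚ ℕ→ℚ n
t+[1+m]-[1+n]≡t+m-n t m n rewrite ℕ→ℚ-suc m | ℕ→ℚ-suc n =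
  solve 3 (λ t m n → t :+ (con 1ℚ :+ m) :- (con 1ℚ :+ n) := t :+ m :- n) refl t (ℕ→ℚ m) (ℕ→ℚ n)

1/[1+n]*[1+n]≡1 : ∀ n → (ℤ.+ 1 / suc n) *ℚ ℕ→ℚ (suc n) ≡ 1ℚ
1/[1+n]*[1+n]≡1 n rewrite ℕ→ℚ≡mkℚ (suc n) | normalize-coprime {1} {n} (1-coprimeTo (suc n)) =
  *-inverseˡ (mkℚ (ℤ.+ suc n) 0 (Coprime.sym (1-coprimeTo (suc n))))

*-cancelʳ-ℕ→ℚ-suc : ∀ n {p q} → p *ℚ ℕ→ℚ (suc n) ≡ q *ℚ ℕ→ℚ (suc n) → p ≡ q
*-cancelʳ-ℕ→ℚ-suc n {p} {q} eq = begin
  p                      ≡⟨ undo p ⟨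
  p *ℚ ℕ→ℚ (suc n) *ℚ w  ≡⟨ cong (_*ℚ w) eq ⟩
  q *ℚ ℕ→ℚ (suc n) *ℚ w  ≡⟨ undo q ⟩
  q                      ∎
  where
  w = ℤ.+ 1 / suc n
  undo : ∀ r → r *ℚ ℕ→ℚ (suc n) *ℚ w ≡ r
  undo r = begin
    r *ℚ ℕ→ℚ (suc n) *ℚ w    ≡⟨ solve 3 (λ r s w → r :* s :* w := r :* (w :* s)) refl r (ℕ→ℚ (suc n)) w ⟩
    r *ℚ (w *ℚ ℕ→ℚ (suc n))  ≡⟨ cong (r *ℚ_) (1/[1+n]*[1+n]≡1 n) ⟩
    r *ℚ 1ℚ                  ≡⟨ *-identityʳ r ⟩
    r                        ∎

gbinom-absorb : ∀ t d → gbinom t (suc d) *ℚ ℕ→ℚ (suc d) ≡ gbinom t d *ℚ (t -ℚ ℕ→ℚ d)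
gbinom-absorb t d = begin
  X *ℚ w *ℚ ℕ→ℚ (suc d)    ≡⟨ *-assoc X w (ℕ→ℚ (suc d)) ⟩
  X *ℚ (w *ℚ ℕ→ℚ (suc d))  ≡⟨ cong (X *ℚ_) (1/[1+n]*[1+n]≡1 d) ⟩
  X *ℚ 1ℚ                  ≡⟨ *-identityʳ X ⟩
  X                        ∎
  where
  X = gbinom t d *ℚ (t -ℚ ℕ→ℚ d)
  w = ℤ.+ 1 / suc d

gbinom-pascal : ∀ t d → gbinom (t +ℚ 1ℚ) (suc d) ≡ gbinom t (suc d) +ℚ gbinom t d
gbinom-pascal t zero    = solve 1 (λ t → con 1ℚ :* (t :+ con 1ℚ :- con 0ℚ) :* con 1ℚ
                                       := con 1ℚ :* (t :- con 0ℚ) :* con 1ℚ :+ con 1ℚ) refl t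
gbinom-pascal t (suc d) = *-cancelʳ-ℕ→ℚ-suc (suc d) (trans lhs (sym rhs))
  where
  s = ℕ→ℚ (suc d)
  s′ = ℕ→ℚ (suc (suc d))
  g₀ = gbinom t d
  g₁ = gbinom t (suc d)
  g₂ = gbinom t (suc (suc d))
  lhs : gbinom (t +ℚ 1ℚ) (suc (suc d)) *ℚ s′ ≡ g₁ *ℚ (t +ℚ 1ℚ)
  lhs = begin
    gbinom (t +ℚ 1ℚ) (suc (suc d)) *ℚ s′
      ≡⟨ gbinom-absorb (t +ℚ 1ℚ) (suc d) ⟩
    gbinom (t +ℚ 1ℚ) (suc d) *ℚ (t +ℚ 1ℚ -ℚ s)
      ≡⟨ cong (_*ℚ (t +ℚ 1ℚ -ℚ s)) (gbinom-pascal t d) ⟩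
    (g₁ +ℚ g₀) *ℚ (t +ℚ 1ℚ -ℚ s)
      ≡⟨ *-distribʳ-+ (t +ℚ 1ℚ -ℚ s) g₁ g₀ ⟩
    g₁ *ℚ (t +ℚ 1ℚ -ℚ s) +ℚ g₀ *ℚ (t +ℚ 1ℚ -ℚ s)
      ≡⟨ cong (λ u → g₁ *ℚ (t +ℚ 1ℚ -ℚ s) +ℚ g₀ *ℚ u) (t+1-[1+n]≡t-n t d) ⟩
    g₁ *ℚ (t +ℚ 1ℚ -ℚ s) +ℚ g₀ *ℚ (t -ℚ ℕ→ℚ d)
      ≡⟨ cong (g₁ *ℚ (t +ℚ 1ℚ -ℚ s) +ℚ_) (gbinom-absorb t d) ⟨
    g₁ *ℚ (t +ℚ 1ℚ -ℚ s) +ℚ g₁ *ℚ s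
      ≡⟨ solve 3 (λ g t s → g :* (t :+ con 1ℚ :- s) :+ g :* s := g :* (t :+ con 1ℚ)) refl g₁ t s ⟩
    g₁ *ℚ (t +ℚ 1ℚ) ∎
  rhs : (g₂ +ℚ g₁) *ℚ s′ ≡ g₁ *ℚ (t +ℚ 1ℚ)
  rhs = begin
    (g₂ +ℚ g₁) *ℚ s′                   ≡⟨ *-distribʳ-+ s′ g₂ g₁ ⟩
    g₂ *ℚ s′ +ℚ g₁ *ℚ s′               ≡⟨ cong (_+ℚ g₁ *ℚ s′) (gbinom-absorb t (suc d)) ⟩
    g₁ *ℚ (t -ℚ s) +ℚ g₁ *ℚ s′         ≡⟨ cong (λ u → g₁ *ℚ (t -ℚ s) +ℚ g₁ *ℚ u) (ℕ→ℚ-suc (suc d)) ⟩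
    g₁ *ℚ (t -ℚ s) +ℚ g₁ *ℚ (1ℚ +ℚ s)
      ≡⟨ solve 3 (λ g t s → g :* (t :- s) :+ g :* (con 1ℚ :+ s) := g :* (t :+ con 1ℚ)) refl g₁ t s ⟩
    g₁ *ℚ (t +ℚ 1ℚ)                    ∎

gbinom-0ℚ : ∀ j → gbinom 0ℚ (suc j) ≡ 0ℚ
gbinom-0ℚ zero    = refl
gbinom-0ℚ (suc j) = begin
  gbinom 0ℚ (suc j) *ℚ (0ℚ -ℚ s) *ℚ w  ≡⟨ cong (λ g → g *ℚ (0ℚ -ℚ s) *ℚ w) (gbinom-0ℚ j) ⟩
  0ℚ *ℚ (0ℚ -ℚ s) *ℚ w                 ≡⟨ cong (_*ℚ w) (*-zeroˡ (0ℚ -ℚ s)) ⟩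
  0ℚ *ℚ w                              ≡⟨ *-zeroˡ w ⟩
  0ℚ                                   ∎
  where
  s = ℕ→ℚ (suc j)
  w = ℤ.+ 1 / suc (suc j)

ℕ→ℚ-C : ∀ n j → ℕ→ℚ (n C j) ≡ gbinom (ℕ→ℚ n) j
ℕ→ℚ-C n       zero    = refl
ℕ→ℚ-C zero    (suc j) = sym (gbinom-0ℚ j)
ℕ→ℚ-C (suc n) (suc j) = begin
  ℕ→ℚ (suc n C suc j)                          ≡⟨ cong ℕ→ℚ (nCk+nC[k+1]≡[n+1]C[k+1] n j) ⟨
  ℕ→ℚ (n C j + n C suc j)                      ≡⟨ ℕ→ℚ-+ (n C j) (n C suc j) ⟩
  ℕ→ℚ (n C j) +ℚ ℕ→ℚ (n C suc j)               ≡⟨ cong₂ _+ℚ_ (ℕ→ℚ-C n j) (ℕ→ℚ-C n (suc j)) ⟩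
  gbinom (ℕ→ℚ n) j +ℚ gbinom (ℕ→ℚ n) (suc j)   ≡⟨ +-comm (gbinom (ℕ→ℚ n) j) (gbinom (ℕ→ℚ n) (suc j)) ⟩
  gbinom (ℕ→ℚ n) (suc j) +ℚ gbinom (ℕ→ℚ n) j   ≡⟨ gbinom-pascal (ℕ→ℚ n) j ⟨
  gbinom (ℕ→ℚ n +ℚ 1ℚ) (suc j)                 ≡⟨ cong (λ t → gbinom t (suc j)) n+1≡[1+n] ⟩
  gbinom (ℕ→ℚ (suc n)) (suc j)                 ∎
  where
  n+1≡[1+n] : ℕ→ℚ n +ℚ 1ℚ ≡ ℕ→ℚ (suc n)
  n+1≡[1+n] = trans (+-comm (ℕ→ℚ n) 1ℚ) (sym (ℕ→ℚ-suc n))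

binomOff-< : ∀ n {i k} → i < k → binomOff n i k ≡ 0
binomOff-< n {zero}  {suc k} _         = refl
binomOff-< n {suc i} {suc k} (s≤s i<k) = binomOff-< n i<k

binomOff-> : ∀ n {i} k → n + k < i → binomOff n i k ≡ 0
binomOff-> n {i}     zero    n+0<i   = k>n⇒nCk≡0 (subst (_< i) (ℕ.+-identityʳ n) n+0<i)
binomOff-> n {suc i} (suc k) n+1+k<1+i = binomOff-> n k (ℕ.≤-pred (subst (_< suc i) (ℕ.+-suc n k) n+1+k<1+i))

binomOff-diag : ∀ n k → binomOff n k k ≡ 1
binomOff-diag n zero    = refl
binomOff-diag n (suc k) = binomOff-diag n k

binomOff-pascal : ∀ n i k → binomOff (suc n) i k ≡ binomOff n i k + binomOff n i (suc k)
binomOff-pascal n zero    zero    = refl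
binomOff-pascal n zero    (suc k) = refl
binomOff-pascal n (suc i) zero    = trans (sym (nCk+nC[k+1]≡[n+1]C[k+1] n i)) (ℕ.+-comm (n C i) (n C suc i))
binomOff-pascal n (suc i) (suc k) = binomOff-pascal n i k

ℕ→ℚ-binomOff-pascal : ∀ n i k →
  ℕ→ℚ (binomOff (suc n) i k) ≡ ℕ→ℚ (binomOff n i k) +ℚ ℕ→ℚ (binomOff n i (suc k))
ℕ→ℚ-binomOff-pascal n i k =
  trans (cong ℕ→ℚ (binomOff-pascal n i k)) (ℕ→ℚ-+ (binomOff n i k) (binomOff n i (suc k)))

binomOff-absorb : ∀ n i k →
  ℕ→ℚ (binomOff n i k) *ℚ (ℕ→ℚ i -ℚ ℕ→ℚ k)
    ≡ ℕ→ℚ (binomOff n i (suc k)) *ℚ (ℕ→ℚ (suc n + k) -ℚ ℕ→ℚ i)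
binomOff-absorb n zero    zero    = sym (*-zeroˡ (ℕ→ℚ (suc n + 0) -ℚ 0ℚ))
binomOff-absorb n zero    (suc k) = trans (*-zeroˡ (0ℚ -ℚ ℕ→ℚ (suc k))) (sym (*-zeroˡ (ℕ→ℚ (suc n + suc k) -ℚ 0ℚ)))
binomOff-absorb n (suc i) zero    = begin
  ℕ→ℚ (n C suc i) *ℚ (ℕ→ℚ (suc i) -ℚ 0ℚ)
    ≡⟨ cong₂ _*ℚ_ (ℕ→ℚ-C n (suc i)) (+-identityʳ (ℕ→ℚ (suc i))) ⟩
  gbinom (ℕ→ℚ n) (suc i) *ℚ ℕ→ℚ (suc i)
    ≡⟨ gbinom-absorb (ℕ→ℚ n) i ⟩
  gbinom (ℕ→ℚ n) i *ℚ (ℕ→ℚ n -ℚ ℕ→ℚ i)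
    ≡⟨ cong₂ _*ℚ_ (ℕ→ℚ-C n i) ([1+m]-[1+n]≡m-n n i) ⟨
  ℕ→ℚ (n C i) *ℚ (ℕ→ℚ (suc n) -ℚ ℕ→ℚ (suc i))
    ≡⟨ cong (λ m → ℕ→ℚ (n C i) *ℚ (ℕ→ℚ m -ℚ ℕ→ℚ (suc i))) (ℕ.+-identityʳ (suc n)) ⟨
  ℕ→ℚ (n C i) *ℚ (ℕ→ℚ (suc n + 0) -ℚ ℕ→ℚ (suc i)) ∎
binomOff-absorb n (suc i) (suc k) = begin
  ℕ→ℚ (binomOff n i k) *ℚ (ℕ→ℚ (suc i) -ℚ ℕ→ℚ (suc k))
    ≡⟨ cong (ℕ→ℚ (binomOff n i k) *ℚ_) ([1+m]-[1+n]≡m-n i k) ⟩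
  ℕ→ℚ (binomOff n i k) *ℚ (ℕ→ℚ i -ℚ ℕ→ℚ k)
    ≡⟨ binomOff-absorb n i k ⟩
  ℕ→ℚ (binomOff n i (suc k)) *ℚ (ℕ→ℚ (suc n + k) -ℚ ℕ→ℚ i)
    ≡⟨ cong (ℕ→ℚ (binomOff n i (suc k)) *ℚ_) ([1+m]-[1+n]≡m-n (suc n + k) i) ⟨
  ℕ→ℚ (binomOff n i (suc k)) *ℚ (ℕ→ℚ (suc (suc n + k)) -ℚ ℕ→ℚ (suc i))
    ≡⟨ cong (λ m → ℕ→ℚ (binomOff n i (suc k)) *ℚ (ℕ→ℚ m -ℚ ℕ→ℚ (suc i))) (ℕ.+-suc (suc n) k) ⟨
  ℕ→ℚ (binomOff n i (suc k)) *ℚ (ℕ→ℚ (suc n + suc k) -ℚ ℕ→ℚ (suc i)) ∎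

coefficient : ℕ → ℕ → ℕ → ℕ → ℕ → ℚ
coefficient A k B l i = ℕ→ℚ (binomOff (l + A) i k) *ℚ ℕ→ℚ (binomOff (B + k) i l)

shift : (ℕ → ℚ) → ℕ → ℚ
shift h zero    = 0ℚ
shift h (suc i) = h i

shift-coefficient : ∀ A k B l i →
  shift (coefficient A k B l) i ≡ ℕ→ℚ (binomOff (l + A) i (suc k)) *ℚ ℕ→ℚ (binomOff (B + k) i (suc l))
shift-coefficient A k B l zero    = refl
shift-coefficient A k B l (suc i) = refl

coefficient-vanishes : ∀ A k B l {i} → l + A + k < i → coefficient A k B l i ≡ 0ℚ
coefficient-vanishes A k B l {i} l+A+k<i = begin
  ℕ→ℚ (binomOff (l + A) i k) *ℚ b  ≡⟨ cong (λ n → ℕ→ℚ n *ℚ b) (binomOff-> (l + A) k l+A+k<i) ⟩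
  0ℚ *ℚ b                          ≡⟨ *-zeroˡ b ⟩
  0ℚ                               ∎
  where
  b = ℕ→ℚ (binomOff (B + k) i l)

coefficient-diag : ∀ A k → coefficient A k 0 0 k ≡ 1ℚ
coefficient-diag A k rewrite binomOff-diag A k | nCn≡1 k = refl

coefficient-off-diag : ∀ A k {i} → i ≢ k → coefficient A k 0 0 i ≡ 0ℚ
coefficient-off-diag A k {i} i≢k with ℕ.<-cmp i k
... | tri< i<k _ _ = trans (cong (λ n → ℕ→ℚ n *ℚ ℕ→ℚ (k C i)) (binomOff-< A i<k)) (*-zeroˡ (ℕ→ℚ (k C i)))
... | tri≈ _ i≡k _ = contradiction i≡k i≢k
... | tri> _ _ i>k =
  trans (cong (λ n → ℕ→ℚ (binomOff A i k) *ℚ ℕ→ℚ n) (k>n⇒nCk≡0 i>k)) (*-zeroʳ (ℕ→ℚ (binomOff A i k)))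

coefficient-pascal : ∀ A k B l i →
  coefficient A k B (suc l) i +ℚ (coefficient A k B l i -ℚ shift (coefficient A k B l) i) ≡ coefficient A k (suc B) l i
coefficient-pascal A k B l i = begin
  ℕ→ℚ (binomOff (suc p) i k) *ℚ b′ +ℚ (a *ℚ b -ℚ shift (coefficient A k B l) i)
    ≡⟨ cong₂ (λ u v → u *ℚ b′ +ℚ (a *ℚ b -ℚ v)) (ℕ→ℚ-binomOff-pascal p i k) (shift-coefficient A k B l i) ⟩
  (a +ℚ a′) *ℚ b′ +ℚ (a *ℚ b -ℚ a′ *ℚ b′)
    ≡⟨ solve 4 (λ a a′ b b′ → (a :+ a′) :* b′ :+ (a :* b :- a′ :* b′) := a :* (b :+ b′)) refl a a′ b b′ ⟩
  a *ℚ (b +ℚ b′)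
    ≡⟨ cong (a *ℚ_) (ℕ→ℚ-binomOff-pascal q i l) ⟨
  a *ℚ ℕ→ℚ (binomOff (suc q) i l) ∎
  where
  p = l + A
  q = B + k
  a = ℕ→ℚ (binomOff p i k)
  a′ = ℕ→ℚ (binomOff p i (suc k))
  b = ℕ→ℚ (binomOff q i l)
  b′ = ℕ→ℚ (binomOff q i (suc l))

coefficient-absorb : ∀ A k B l i →
  coefficient A k B (suc l) i *ℚ ℕ→ℚ (suc (B + l))
    ≡ coefficient A k B l i *ℚ (ℕ→ℚ i -ℚ ℕ→ℚ l)
      +ℚ shift (coefficient A k B l) i *ℚ (ℕ→ℚ (suc (suc (B + l + (A + k))) + l) -ℚ ℕ→ℚ i)
coefficient-absorb A k B l i = begin
  ℕ→ℚ (binomOff (suc p) i k) *ℚ b′ *ℚ S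
    ≡⟨ cong (λ u → u *ℚ b′ *ℚ S) (ℕ→ℚ-binomOff-pascal p i k) ⟩
  (a +ℚ a′) *ℚ b′ *ℚ S
    ≡⟨ combine (binomOff-absorb p i k) (trans (binomOff-absorb q i l) (cong (λ n → b′ *ℚ (n -ℚ I)) Q≡S+K)) ⟩
  a *ℚ b *ℚ (I -ℚ L) +ℚ a′ *ℚ b′ *ℚ (S +ℚ P -ℚ I)
    ≡⟨ cong₂ (λ u v → a *ℚ b *ℚ (I -ℚ L) +ℚ u *ℚ (v -ℚ I)) (shift-coefficient A k B l i) V≡S+P ⟨
  a *ℚ b *ℚ (I -ℚ L) +ℚ shift (coefficient A k B l) i *ℚ (ℕ→ℚ (suc (suc (B + l + (A + k))) + l) -ℚ I) ∎
  where
  p = l + A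
  q = B + k
  a = ℕ→ℚ (binomOff p i k)
  a′ = ℕ→ℚ (binomOff p i (suc k))
  b = ℕ→ℚ (binomOff q i l)
  b′ = ℕ→ℚ (binomOff q i (suc l))
  I = ℕ→ℚ i
  K = ℕ→ℚ k
  L = ℕ→ℚ l
  S = ℕ→ℚ (suc (B + l))
  P = ℕ→ℚ (suc p + k)
  Q≡S+K : ℕ→ℚ (suc q + l) ≡ S +ℚ K
  Q≡S+K = trans (cong ℕ→ℚ q′≡s+k) (ℕ→ℚ-+ (suc (B + l)) k)
    where
    q′≡s+k : suc (B + k) + l ≡ suc (B + l) + k
    q′≡s+k = ℕ-Solver.solve (B ∷ k ∷ l ∷ [])
  V≡S+P : ℕ→ℚ (suc (suc (B + l + (A + k))) + l) ≡ S +ℚ P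
  V≡S+P = trans (cong ℕ→ℚ v≡s+p′) (ℕ→ℚ-+ (suc (B + l)) (suc p + k))
    where
    v≡s+p′ : suc (suc (B + l + (A + k))) + l ≡ suc (B + l) + (suc (l + A) + k)
    v≡s+p′ = ℕ-Solver.solve (A ∷ B ∷ k ∷ l ∷ [])
  combine : a *ℚ (I -ℚ K) ≡ a′ *ℚ (P -ℚ I) → b *ℚ (I -ℚ L) ≡ b′ *ℚ (S +ℚ K -ℚ I) →
            (a +ℚ a′) *ℚ b′ *ℚ S ≡ a *ℚ b *ℚ (I -ℚ L) +ℚ a′ *ℚ b′ *ℚ (S +ℚ P -ℚ I)
  combine ha hb = sym (begin
    a *ℚ b *ℚ (I -ℚ L) +ℚ R
      ≡⟨ cong (_+ℚ R) (*-assoc a b (I -ℚ L)) ⟩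
    a *ℚ (b *ℚ (I -ℚ L)) +ℚ R
      ≡⟨ cong (λ u → a *ℚ u +ℚ R) hb ⟩
    a *ℚ (b′ *ℚ (S +ℚ K -ℚ I)) +ℚ a′ *ℚ b′ *ℚ (S +ℚ P -ℚ I)
      ≡⟨ solve 7 (λ a a′ b′ I K S P → a :* (b′ :* (S :+ K :- I)) :+ a′ :* b′ :* (S :+ P :- I)
                                    := (a :+ a′) :* b′ :* S :+ b′ :* (a′ :* (P :- I) :- a :* (I :- K)))
                 refl a a′ b′ I K S P ⟩
    (a +ℚ a′) *ℚ b′ *ℚ S +ℚ b′ *ℚ (a′ *ℚ (P -ℚ I) -ℚ a *ℚ (I -ℚ K))
      ≡⟨ cong (λ u → (a +ℚ a′) *ℚ b′ *ℚ S +ℚ b′ *ℚ (a′ *ℚ (P -ℚ I) -ℚ u)) ha ⟩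
    (a +ℚ a′) *ℚ b′ *ℚ S +ℚ b′ *ℚ (a′ *ℚ (P -ℚ I) -ℚ a′ *ℚ (P -ℚ I))
      ≡⟨ solve 3 (λ z b′ y → z :+ b′ :* (y :- y) := z) refl ((a +ℚ a′) *ℚ b′ *ℚ S) b′ (a′ *ℚ (P -ℚ I)) ⟩
    (a +ℚ a′) *ℚ b′ *ℚ S ∎)
    where
    R = a′ *ℚ b′ *ℚ (S +ℚ P -ℚ I)

sumF≡sum : ∀ {n} (f : Fin n → ℚ) → sumF f ≡ sum f
sumF≡sum {zero}  f = refl
sumF≡sum {suc n} f = cong (f Fin.zero +ℚ_) (sumF≡sum (λ i → f (Fin.suc i)))

∑-single : ∀ n (f : ℕ → ℚ) {j} → j < n → (∀ i → i ≢ j → f i ≡ 0ℚ) → sum {n} (λ i → f (toℕ i)) ≡ f j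
∑-single (suc n) f {zero} _ f≡0 = begin
  f 0 +ℚ sum {n} (λ i → f (suc (toℕ i)))  ≡⟨ cong (f 0 +ℚ_) rest≡0 ⟩
  f 0 +ℚ 0ℚ                               ≡⟨ +-identityʳ (f 0) ⟩
  f 0                                     ∎
  where
  rest≡0 : sum {n} (λ i → f (suc (toℕ i))) ≡ 0ℚ
  rest≡0 = trans (sum-cong-≗ {n} (λ i → f≡0 (suc (toℕ i)) (λ ()))) (sum-replicate-zero n)
∑-single (suc n) f {suc j} (s≤s j<n) f≡0 = begin
  f 0 +ℚ sum {n} (λ i → f (suc (toℕ i)))  ≡⟨ cong₂ _+ℚ_ (f≡0 0 (λ ())) (∑-single n (f ∘ suc) j<n f∘suc≡0) ⟩
  0ℚ +ℚ f (suc j)                         ≡⟨ +-identityˡ (f (suc j)) ⟩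
  f (suc j)                               ∎
  where
  f∘suc≡0 : ∀ i → i ≢ j → f (suc i) ≡ 0ℚ
  f∘suc≡0 i i≢j = f≡0 (suc i) (i≢j ∘ ℕ.suc-injective)

∑-drop-boundary : ∀ N (f g : ℕ → ℚ) → f (suc N) ≡ 0ℚ → g 0 ≡ 0ℚ →
  sum {suc (suc N)} (λ i → f (toℕ i) +ℚ g (toℕ i)) ≡ sum {suc N} (λ i → f (toℕ i) +ℚ g (suc (toℕ i)))
∑-drop-boundary N f g f-top g-bottom = begin
  sum {suc (suc N)} (λ i → f (toℕ i) +ℚ g (toℕ i))
    ≡⟨ ∑-distrib-+ {suc (suc N)} (f ∘ toℕ) (g ∘ toℕ) ⟩
  sum {suc (suc N)} (f ∘ toℕ) +ℚ sum {suc (suc N)} (g ∘ toℕ)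
    ≡⟨ cong₂ _+ℚ_ drop-top drop-bottom ⟩
  sum {suc N} (f ∘ toℕ) +ℚ sum {suc N} (g ∘ suc ∘ toℕ)
    ≡⟨ ∑-distrib-+ {suc N} (f ∘ toℕ) (g ∘ suc ∘ toℕ) ⟨
  sum {suc N} (λ i → f (toℕ i) +ℚ g (suc (toℕ i))) ∎
  where
  drop-top : sum {suc (suc N)} (f ∘ toℕ) ≡ sum {suc N} (f ∘ toℕ)
  drop-top = begin
    sum {suc (suc N)} (f ∘ toℕ)
      ≡⟨ sum-init-last {suc N} (f ∘ toℕ) ⟩
    sum {suc N} (f ∘ toℕ ∘ Fin.inject₁) +ℚ f (toℕ (Fin.fromℕ (suc N)))
      ≡⟨ cong₂ _+ℚ_ (sum-cong-≗ {suc N} (cong f ∘ toℕ-inject₁)) (trans (cong f (toℕ-fromℕ (suc N))) f-top) ⟩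
    sum {suc N} (f ∘ toℕ) +ℚ 0ℚ
      ≡⟨ +-identityʳ (sum {suc N} (f ∘ toℕ)) ⟩
    sum {suc N} (f ∘ toℕ) ∎
  drop-bottom : sum {suc (suc N)} (g ∘ toℕ) ≡ sum {suc N} (g ∘ suc ∘ toℕ)
  drop-bottom = trans (cong (_+ℚ sum {suc N} (g ∘ suc ∘ toℕ)) g-bottom) (+-identityˡ (sum {suc N} (g ∘ suc ∘ toℕ)))

module _ (x : ℚ) where

  basis : ℕ → ℕ → ℚ
  basis N i = gbinom (x +ℚ ℕ→ℚ N -ℚ ℕ→ℚ i) N

  basis-pascal : ∀ N i → basis (suc N) i ≡ basis (suc N) (suc i) +ℚ basis N i
  basis-pascal N i = begin
    gbinom (x +ℚ ℕ→ℚ (suc N) -ℚ ℕ→ℚ i) (suc N)  ≡⟨ cong (λ u → gbinom u (suc N)) x+[1+N]-i≡t+1 ⟩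
    gbinom (t +ℚ 1ℚ) (suc N)                    ≡⟨ gbinom-pascal t N ⟩
    gbinom t (suc N) +ℚ gbinom t N              ≡⟨ cong (λ u → gbinom u (suc N) +ℚ gbinom t N) (t+[1+m]-[1+n]≡t+m-n x N i) ⟨
    basis (suc N) (suc i) +ℚ basis N i          ∎
    where
    t = x +ℚ ℕ→ℚ N -ℚ ℕ→ℚ i
    x+[1+N]-i≡t+1 : x +ℚ ℕ→ℚ (suc N) -ℚ ℕ→ℚ i ≡ t +ℚ 1ℚ
    x+[1+N]-i≡t+1 = trans (cong (_-ℚ ℕ→ℚ i) (t+[1+n]≡t+n+1 x N))
      (solve 3 (λ x n i → x :+ n :+ con 1ℚ :- i := x :+ n :- i :+ con 1ℚ) refl x (ℕ→ℚ N) (ℕ→ℚ i))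

  basis-absorb : ∀ N i → basis (suc N) (suc i) *ℚ ℕ→ℚ (suc N) ≡ basis N i *ℚ (x -ℚ ℕ→ℚ i)
  basis-absorb N i = begin
    gbinom (x +ℚ ℕ→ℚ (suc N) -ℚ ℕ→ℚ (suc i)) (suc N) *ℚ ℕ→ℚ (suc N)
      ≡⟨ cong (λ u → gbinom u (suc N) *ℚ ℕ→ℚ (suc N)) (t+[1+m]-[1+n]≡t+m-n x N i) ⟩
    gbinom t (suc N) *ℚ ℕ→ℚ (suc N)
      ≡⟨ gbinom-absorb t N ⟩
    basis N i *ℚ (t -ℚ ℕ→ℚ N)
      ≡⟨ cong (basis N i *ℚ_) (solve 3 (λ x n i → x :+ n :- i :- n := x :- i) refl x (ℕ→ℚ N) (ℕ→ℚ i)) ⟩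
    basis N i *ℚ (x -ℚ ℕ→ℚ i) ∎
    where
    t = x +ℚ ℕ→ℚ N -ℚ ℕ→ℚ i

  basis-*-[x-m] : ∀ N m i →
    basis N i *ℚ (x -ℚ ℕ→ℚ m)
      ≡ (ℕ→ℚ i -ℚ ℕ→ℚ m) *ℚ basis (suc N) i
        +ℚ (ℕ→ℚ (suc (suc N) + m) -ℚ ℕ→ℚ (suc i)) *ℚ basis (suc N) (suc i)
  basis-*-[x-m] N m i = sym (begin
    (I -ℚ M) *ℚ basis (suc N) i +ℚ (ℕ→ℚ (suc (suc N) + m) -ℚ ℕ→ℚ (suc i)) *ℚ H₁
      ≡⟨ cong₂ (λ u v → (I -ℚ M) *ℚ u +ℚ v *ℚ H₁) (basis-pascal N i) v≡s+m-i ⟩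
    (I -ℚ M) *ℚ (H₁ +ℚ H) +ℚ (s +ℚ M -ℚ I) *ℚ H₁
      ≡⟨ solve 5 (λ I M s H H₁ → (I :- M) :* (H₁ :+ H) :+ (s :+ M :- I) :* H₁ := (I :- M) :* H :+ H₁ :* s)
                 refl I M s H H₁ ⟩
    (I -ℚ M) *ℚ H +ℚ H₁ *ℚ s
      ≡⟨ cong ((I -ℚ M) *ℚ H +ℚ_) (basis-absorb N i) ⟩
    (I -ℚ M) *ℚ H +ℚ H *ℚ (x -ℚ I)
      ≡⟨ solve 4 (λ I M x H → (I :- M) :* H :+ H :* (x :- I) := H :* (x :- M)) refl I M x H ⟩
    H *ℚ (x -ℚ M) ∎)
    where
    I = ℕ→ℚ i
    M = ℕ→ℚ m
    s = ℕ→ℚ (suc N)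
    H = basis N i
    H₁ = basis (suc N) (suc i)
    v≡s+m-i : ℕ→ℚ (suc (suc N) + m) -ℚ ℕ→ℚ (suc i) ≡ s +ℚ M -ℚ I
    v≡s+m-i = trans ([1+m]-[1+n]≡m-n (suc N + m) i) (cong (_-ℚ I) (ℕ→ℚ-+ (suc N) m))

  basis-offset : ∀ A {k a} → A + k ≡ a → basis a k ≡ gbinom (x +ℚ ℕ→ℚ A) a
  basis-offset A {k} refl = cong (λ t → gbinom t (A + k)) (begin
    x +ℚ ℕ→ℚ (A + k) -ℚ ℕ→ℚ k        ≡⟨ cong (λ n → x +ℚ n -ℚ ℕ→ℚ k) (ℕ→ℚ-+ A k) ⟩
    x +ℚ (ℕ→ℚ A +ℚ ℕ→ℚ k) -ℚ ℕ→ℚ k  ≡⟨ solve 3 (λ x a k → x :+ (a :+ k) :- k := x :+ a) refl x (ℕ→ℚ A) (ℕ→ℚ k) ⟩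
    x +ℚ ℕ→ℚ A                       ∎)

  Tinv≡∑ : ∀ N (h : Hom N) → Tinv N h x ≡ sum {suc N} (λ i → h i *ℚ basis N (toℕ i))
  Tinv≡∑ N h = sumF≡sum {suc N} (λ i → h i *ℚ basis N (toℕ i))

  Tinv-cong : ∀ N {h h′ : Hom N} → (∀ i → h i ≡ h′ i) → Tinv N h x ≡ Tinv N h′ x
  Tinv-cong N {h} {h′} h≗h′ = begin
    Tinv N h x                                    ≡⟨ Tinv≡∑ N h ⟩
    sum {suc N} (λ i → h i *ℚ basis N (toℕ i))    ≡⟨ sum-cong-≗ {suc N} (λ i → cong (_*ℚ basis N (toℕ i)) (h≗h′ i)) ⟩
    sum {suc N} (λ i → h′ i *ℚ basis N (toℕ i))   ≡⟨ Tinv≡∑ N h′ ⟨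
    Tinv N h′ x                                   ∎

  Tinv-+ : ∀ N (h h′ : Hom N) → Tinv N h x +ℚ Tinv N h′ x ≡ Tinv N (λ i → h i +ℚ h′ i) x
  Tinv-+ N h h′ = begin
    Tinv N h x +ℚ Tinv N h′ x
      ≡⟨ cong₂ _+ℚ_ (Tinv≡∑ N h) (Tinv≡∑ N h′) ⟩
    sum {suc N} (λ i → h i *ℚ basis N (toℕ i)) +ℚ sum {suc N} (λ i → h′ i *ℚ basis N (toℕ i))
      ≡⟨ ∑-distrib-+ {suc N} (λ i → h i *ℚ basis N (toℕ i)) (λ i → h′ i *ℚ basis N (toℕ i)) ⟨
    sum {suc N} (λ i → h i *ℚ basis N (toℕ i) +ℚ h′ i *ℚ basis N (toℕ i))
      ≡⟨ sum-cong-≗ {suc N} (λ i → *-distribʳ-+ (basis N (toℕ i)) (h i) (h′ i)) ⟨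
    sum {suc N} (λ i → (h i +ℚ h′ i) *ℚ basis N (toℕ i))
      ≡⟨ Tinv≡∑ N (λ i → h i +ℚ h′ i) ⟨
    Tinv N (λ i → h i +ℚ h′ i) x ∎

  Tinv-*ʳ : ∀ N (h : Hom N) s → Tinv N h x *ℚ s ≡ Tinv N (λ i → h i *ℚ s) x
  Tinv-*ʳ N h s = begin
    Tinv N h x *ℚ s                                   ≡⟨ cong (_*ℚ s) (Tinv≡∑ N h) ⟩
    sum {suc N} (λ i → h i *ℚ basis N (toℕ i)) *ℚ s   ≡⟨ *-distribʳ-sum {suc N} s (λ i → h i *ℚ basis N (toℕ i)) ⟩
    sum {suc N} (λ i → h i *ℚ basis N (toℕ i) *ℚ s)   ≡⟨ sum-cong-≗ {suc N} (λ i → swap (h i) (basis N (toℕ i))) ⟩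
    sum {suc N} (λ i → h i *ℚ s *ℚ basis N (toℕ i))   ≡⟨ Tinv≡∑ N (λ i → h i *ℚ s) ⟨
    Tinv N (λ i → h i *ℚ s) x                         ∎
    where
    swap : ∀ a b → a *ℚ b *ℚ s ≡ a *ℚ s *ℚ b
    swap a b = solve 3 (λ a b s → a :* b :* s := a :* s :* b) refl a b s

  Tinv-single : ∀ N (h : ℕ → ℚ) {j} → j ≤ N → (∀ i → i ≢ j → h i ≡ 0ℚ) →
    Tinv N (λ i → h (toℕ i)) x ≡ h j *ℚ basis N j
  Tinv-single N h {j} j≤N h≡0 =
    trans (Tinv≡∑ N (h ∘ toℕ)) (∑-single (suc N) (λ i → h i *ℚ basis N i) (s≤s j≤N) hB≡0)
    where
    hB≡0 : ∀ i → i ≢ j → h i *ℚ basis N i ≡ 0ℚ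
    hB≡0 i i≢j = trans (cong (_*ℚ basis N i) (h≡0 i i≢j)) (*-zeroˡ (basis N i))

  Tinv-monomial : ∀ A {k a} → A + k ≡ a → Tinv a (monomial a k) x ≡ gbinom (x +ℚ ℕ→ℚ A) a
  Tinv-monomial A {k} refl = begin
    Tinv (A + k) (monomial (A + k) k) x  ≡⟨ Tinv-single (A + k) δ (ℕ.m≤n+m k A) δ-off ⟩
    δ k *ℚ basis (A + k) k               ≡⟨ cong (_*ℚ basis (A + k) k) δ-on ⟩
    1ℚ *ℚ basis (A + k) k                ≡⟨ *-identityˡ (basis (A + k) k) ⟩
    basis (A + k) k                      ≡⟨ basis-offset A refl ⟩
    gbinom (x +ℚ ℕ→ℚ A) (A + k)          ∎
    where
    δ : ℕ → ℚ
    δ i = if i ≡ᵇ k then 1ℚ else 0ℚ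
    δ-on : δ k ≡ 1ℚ
    δ-on = cong (λ b → if b then 1ℚ else 0ℚ) (Equivalence.to T-≡ (ℕ.≡⇒≡ᵇ k k refl))
    δ-off : ∀ i → i ≢ k → δ i ≡ 0ℚ
    δ-off i i≢k with i ≡ᵇ k in i≡ᵇk
    ... | true  = contradiction (ℕ.≡ᵇ⇒≡ i k (Equivalence.from T-≡ i≡ᵇk)) i≢k
    ... | false = refl

  Tinv-*-step : ∀ N (h u v : ℕ → ℚ) p → h (suc N) ≡ 0ℚ →
    (∀ i → basis N i *ℚ p ≡ u i *ℚ basis (suc N) i +ℚ v (suc i) *ℚ basis (suc N) (suc i)) →
    Tinv N (λ i → h (toℕ i)) x *ℚ p
      ≡ Tinv (suc N) (λ i → h (toℕ i) *ℚ u (toℕ i) +ℚ shift h (toℕ i) *ℚ v (toℕ i)) x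
  Tinv-*-step N h u v p h-top step = begin
    Tinv N (h ∘ toℕ) x *ℚ p
      ≡⟨ cong (_*ℚ p) (Tinv≡∑ N (h ∘ toℕ)) ⟩
    sum {suc N} (λ i → h (toℕ i) *ℚ basis N (toℕ i)) *ℚ p
      ≡⟨ *-distribʳ-sum {suc N} p (λ i → h (toℕ i) *ℚ basis N (toℕ i)) ⟩
    sum {suc N} (λ i → h (toℕ i) *ℚ basis N (toℕ i) *ℚ p)
      ≡⟨ sum-cong-≗ {suc N} (split ∘ toℕ) ⟩
    sum {suc N} (λ i → f (toℕ i) +ℚ g (suc (toℕ i)))
      ≡⟨ ∑-drop-boundary N f g f-top g-bottom ⟨
    sum {suc (suc N)} (λ i → f (toℕ i) +ℚ g (toℕ i))
      ≡⟨ sum-cong-≗ {suc (suc N)} (merge ∘ toℕ) ⟩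
    sum {suc (suc N)} (λ i → (h (toℕ i) *ℚ u (toℕ i) +ℚ shift h (toℕ i) *ℚ v (toℕ i)) *ℚ basis (suc N) (toℕ i))
      ≡⟨ Tinv≡∑ (suc N) (λ i → h (toℕ i) *ℚ u (toℕ i) +ℚ shift h (toℕ i) *ℚ v (toℕ i)) ⟨
    Tinv (suc N) (λ i → h (toℕ i) *ℚ u (toℕ i) +ℚ shift h (toℕ i) *ℚ v (toℕ i)) x ∎
    where
    f g : ℕ → ℚ
    f i = h i *ℚ u i *ℚ basis (suc N) i
    g i = shift h i *ℚ v i *ℚ basis (suc N) i
    split : ∀ i → h i *ℚ basis N i *ℚ p ≡ f i +ℚ g (suc i)
    split i = begin
      h i *ℚ basis N i *ℚ p                                                    ≡⟨ *-assoc (h i) (basis N i) p ⟩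
      h i *ℚ (basis N i *ℚ p)                                                  ≡⟨ cong (h i *ℚ_) (step i) ⟩
      h i *ℚ (u i *ℚ basis (suc N) i +ℚ v (suc i) *ℚ basis (suc N) (suc i))
        ≡⟨ solve 5 (λ h u b v b′ → h :* (u :* b :+ v :* b′) := h :* u :* b :+ h :* v :* b′)
                   refl (h i) (u i) (basis (suc N) i) (v (suc i)) (basis (suc N) (suc i)) ⟩
      f i +ℚ g (suc i)                                                         ∎
    merge : ∀ i → f i +ℚ g i ≡ (h i *ℚ u i +ℚ shift h i *ℚ v i) *ℚ basis (suc N) i
    merge i = sym (*-distribʳ-+ (basis (suc N) i) (h i *ℚ u i) (shift h i *ℚ v i))
    f-top : f (suc N) ≡ 0ℚ
    f-top = begin
      h (suc N) *ℚ u (suc N) *ℚ H  ≡⟨ cong (λ z → z *ℚ u (suc N) *ℚ H) h-top ⟩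
      0ℚ *ℚ u (suc N) *ℚ H         ≡⟨ cong (_*ℚ H) (*-zeroˡ (u (suc N))) ⟩
      0ℚ *ℚ H                      ≡⟨ *-zeroˡ H ⟩
      0ℚ                           ∎
      where
      H = basis (suc N) (suc N)
    g-bottom : g 0 ≡ 0ℚ
    g-bottom = trans (cong (_*ℚ basis (suc N) 0) (*-zeroˡ (v 0))) (*-zeroˡ (basis (suc N) 0))

  Tinv-raise : ∀ N (h : ℕ → ℚ) → h (suc N) ≡ 0ℚ →
    Tinv N (λ i → h (toℕ i)) x ≡ Tinv (suc N) (λ i → h (toℕ i) -ℚ shift h (toℕ i)) x
  Tinv-raise N h h-top = begin
    Tinv N (h ∘ toℕ) x
      ≡⟨ *-identityʳ (Tinv N (h ∘ toℕ) x) ⟨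
    Tinv N (h ∘ toℕ) x *ℚ 1ℚ
      ≡⟨ Tinv-*-step N h (λ _ → 1ℚ) (λ _ → - 1ℚ) 1ℚ h-top step ⟩
    Tinv (suc N) (λ i → h (toℕ i) *ℚ 1ℚ +ℚ shift h (toℕ i) *ℚ - 1ℚ) x
      ≡⟨ Tinv-cong (suc N) (λ i → simplify (h (toℕ i)) (shift h (toℕ i))) ⟩
    Tinv (suc N) (λ i → h (toℕ i) -ℚ shift h (toℕ i)) x ∎
    where
    step : ∀ i → basis N i *ℚ 1ℚ ≡ 1ℚ *ℚ basis (suc N) i +ℚ - 1ℚ *ℚ basis (suc N) (suc i)
    step i = begin
      basis N i *ℚ 1ℚ
        ≡⟨ solve 2 (λ h h₁ → h :* con 1ℚ := con 1ℚ :* (h₁ :+ h) :+ con (- 1ℚ) :* h₁)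
                   refl (basis N i) (basis (suc N) (suc i)) ⟩
      1ℚ *ℚ (basis (suc N) (suc i) +ℚ basis N i) +ℚ - 1ℚ *ℚ basis (suc N) (suc i)
        ≡⟨ cong (λ u → 1ℚ *ℚ u +ℚ - 1ℚ *ℚ basis (suc N) (suc i)) (basis-pascal N i) ⟨
      1ℚ *ℚ basis (suc N) i +ℚ - 1ℚ *ℚ basis (suc N) (suc i) ∎
    simplify : ∀ a b → a *ℚ 1ℚ +ℚ b *ℚ - 1ℚ ≡ a -ℚ b
    simplify = solve 2 (λ a b → a :* con 1ℚ :+ b :* con (- 1ℚ) := a :- b) refl

  Tinv-*-[x-m] : ∀ N m (h : ℕ → ℚ) → h (suc N) ≡ 0ℚ →
    Tinv N (λ i → h (toℕ i)) x *ℚ (x -ℚ ℕ→ℚ m)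
      ≡ Tinv (suc N) (λ i → h (toℕ i) *ℚ (ℕ→ℚ (toℕ i) -ℚ ℕ→ℚ m)
                            +ℚ shift h (toℕ i) *ℚ (ℕ→ℚ (suc (suc N) + m) -ℚ ℕ→ℚ (toℕ i))) x
  Tinv-*-[x-m] N m h h-top =
    Tinv-*-step N h (λ i → ℕ→ℚ i -ℚ ℕ→ℚ m) (λ j → ℕ→ℚ (suc (suc N) + m) -ℚ ℕ→ℚ j) (x -ℚ ℕ→ℚ m)
                h-top (basis-*-[x-m] N m)

  module _ (A k : ℕ) where

    -- The degree is written b + (A + k) so that raising B or l turns it into a definitional suc.
    Expands : ℕ → ℕ → ℕ → Set
    Expands B l b = gbinom (x +ℚ ℕ→ℚ A) (A + k) *ℚ gbinom (x +ℚ ℕ→ℚ B) b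
                  ≡ Tinv (b + (A + k)) (λ i → coefficient A k B l (toℕ i)) x

    top-coefficient-vanishes : ∀ B l {b} → B + l ≡ b → coefficient A k B l (suc (b + (A + k))) ≡ 0ℚ
    top-coefficient-vanishes B l refl = coefficient-vanishes A k B l (s≤s l+A+k≤B+l+[A+k])
      where
      l+A+k≤B+l+[A+k] : l + A + k ≤ B + l + (A + k)
      l+A+k≤B+l+[A+k] = ℕ.≤-trans (ℕ.≤-reflexive (ℕ.+-assoc l A k)) (ℕ.+-monoˡ-≤ (A + k) (ℕ.m≤n+m l B))

    expands-base : Expands 0 0 0
    expands-base = begin
      gA *ℚ 1ℚ                                   ≡⟨ *-identityʳ gA ⟩
      gA                                         ≡⟨ basis-offset A refl ⟨
      basis (A + k) k                            ≡⟨ *-identityˡ (basis (A + k) k) ⟨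
      1ℚ *ℚ basis (A + k) k                      ≡⟨ cong (_*ℚ basis (A + k) k) (coefficient-diag A k) ⟨
      coefficient A k 0 0 k *ℚ basis (A + k) k   ≡⟨ Tinv-single (A + k) (coefficient A k 0 0) (ℕ.m≤n+m k A)
                                                                (λ i → coefficient-off-diag A k) ⟨
      Tinv (A + k) (λ i → coefficient A k 0 0 (toℕ i)) x ∎
      where
      gA = gbinom (x +ℚ ℕ→ℚ A) (A + k)

    expands-suc-B : ∀ B l {b} → B + l ≡ b → Expands B (suc l) (suc b) → Expands B l b → Expands (suc B) l (suc b)
    expands-suc-B B l {b} B+l≡b hyp⁺ hyp = begin
      gA *ℚ gbinom (x +ℚ ℕ→ℚ (suc B)) (suc b)
        ≡⟨ cong (λ t → gA *ℚ gbinom t (suc b)) (t+[1+n]≡t+n+1 x B) ⟩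
      gA *ℚ gbinom (x +ℚ ℕ→ℚ B +ℚ 1ℚ) (suc b)
        ≡⟨ cong (gA *ℚ_) (gbinom-pascal (x +ℚ ℕ→ℚ B) b) ⟩
      gA *ℚ (gbinom (x +ℚ ℕ→ℚ B) (suc b) +ℚ gbinom (x +ℚ ℕ→ℚ B) b)
        ≡⟨ *-distribˡ-+ gA (gbinom (x +ℚ ℕ→ℚ B) (suc b)) (gbinom (x +ℚ ℕ→ℚ B) b) ⟩
      gA *ℚ gbinom (x +ℚ ℕ→ℚ B) (suc b) +ℚ gA *ℚ gbinom (x +ℚ ℕ→ℚ B) b
        ≡⟨ cong₂ _+ℚ_ hyp⁺ (trans hyp (Tinv-raise N c (top-coefficient-vanishes B l B+l≡b))) ⟩
      Tinv (suc N) (c⁺ ∘ toℕ) x +ℚ Tinv (suc N) (λ i → c (toℕ i) -ℚ shift c (toℕ i)) x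
        ≡⟨ Tinv-+ (suc N) (c⁺ ∘ toℕ) (λ i → c (toℕ i) -ℚ shift c (toℕ i)) ⟩
      Tinv (suc N) (λ i → c⁺ (toℕ i) +ℚ (c (toℕ i) -ℚ shift c (toℕ i))) x
        ≡⟨ Tinv-cong (suc N) (λ i → coefficient-pascal A k B l (toℕ i)) ⟩
      Tinv (suc N) (λ i → coefficient A k (suc B) l (toℕ i)) x ∎
      where
      gA = gbinom (x +ℚ ℕ→ℚ A) (A + k)
      N = b + (A + k)
      c = coefficient A k B l
      c⁺ = coefficient A k B (suc l)

    expands-suc-l : ∀ l → Expands 0 l l → Expands 0 (suc l) (suc l)
    expands-suc-l l hyp = *-cancelʳ-ℕ→ℚ-suc l (begin
      gA *ℚ gbinom x₀ (suc l) *ℚ ℕ→ℚ (suc l)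
        ≡⟨ *-assoc gA (gbinom x₀ (suc l)) (ℕ→ℚ (suc l)) ⟩
      gA *ℚ (gbinom x₀ (suc l) *ℚ ℕ→ℚ (suc l))
        ≡⟨ cong (gA *ℚ_) (gbinom-absorb x₀ l) ⟩
      gA *ℚ (gbinom x₀ l *ℚ (x₀ -ℚ ℕ→ℚ l))
        ≡⟨ solve 4 (λ a g x m → a :* (g :* (x :+ con 0ℚ :- m)) := a :* g :* (x :- m)) refl gA (gbinom x₀ l) x (ℕ→ℚ l) ⟩
      gA *ℚ gbinom x₀ l *ℚ (x -ℚ ℕ→ℚ l)
        ≡⟨ cong (_*ℚ (x -ℚ ℕ→ℚ l)) hyp ⟩
      Tinv N (c ∘ toℕ) x *ℚ (x -ℚ ℕ→ℚ l)
        ≡⟨ Tinv-*-[x-m] N l c (top-coefficient-vanishes 0 l refl) ⟩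
      Tinv (suc N) (λ i → c (toℕ i) *ℚ (ℕ→ℚ (toℕ i) -ℚ ℕ→ℚ l)
                          +ℚ shift c (toℕ i) *ℚ (ℕ→ℚ (suc (suc N) + l) -ℚ ℕ→ℚ (toℕ i))) x
        ≡⟨ Tinv-cong (suc N) (λ i → coefficient-absorb A k 0 l (toℕ i)) ⟨
      Tinv (suc N) (λ i → coefficient A k 0 (suc l) (toℕ i) *ℚ ℕ→ℚ (suc l)) x
        ≡⟨ Tinv-*ʳ (suc N) (λ i → coefficient A k 0 (suc l) (toℕ i)) (ℕ→ℚ (suc l)) ⟨
      Tinv (suc N) (λ i → coefficient A k 0 (suc l) (toℕ i)) x *ℚ ℕ→ℚ (suc l) ∎)
      where
      gA = gbinom (x +ℚ ℕ→ℚ A) (A + k)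
      x₀ = x +ℚ ℕ→ℚ 0
      N = l + (A + k)
      c = coefficient A k 0 l

    expands : ∀ B l {b} → B + l ≡ b → Expands B l b
    expands zero    zero    refl = expands-base
    expands zero    (suc l) refl = expands-suc-l l (expands zero l refl)
    expands (suc B) l       refl = expands-suc-B B l refl (expands B (suc l) (ℕ.+-suc B l)) (expands B l refl)

  expansion : ∀ A k B l {a b} → A + k ≡ a → B + l ≡ b →
    gbinom (x +ℚ ℕ→ℚ A) a *ℚ gbinom (x +ℚ ℕ→ℚ B) b ≡ Tinv (b + a) (λ i → coefficient A k B l (toℕ i)) x
  expansion A k B l refl B+l≡b = expands A k B l B+l≡b

lemma2p3 : (a b k l : ℕ) → k ≤ a → l ≤ b →
    BulletEq a b (monomial a k) (monomial b l)
      (λ i → ℕ→ℚ (binomOff (a ∸ k + l) (toℕ i) k * binomOff (b ∸ l + k) (toℕ i) l))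
lemma2p3 a b k l k≤a l≤b x = begin
  Tinv (a + b) (λ i → r (toℕ i)) x
    ≡⟨ cong (λ N → Tinv N (λ i → r (toℕ i)) x) (ℕ.+-comm a b) ⟩
  Tinv (b + a) (λ i → r (toℕ i)) x
    ≡⟨ Tinv-cong x (b + a) (λ i → r≡coefficient (toℕ i)) ⟩
  Tinv (b + a) (λ i → coefficient (a ∸ k) k (b ∸ l) l (toℕ i)) x
    ≡⟨ expansion x (a ∸ k) k (b ∸ l) l (ℕ.m∸n+n≡m k≤a) (ℕ.m∸n+n≡m l≤b) ⟨
  gbinom (x +ℚ ℕ→ℚ (a ∸ k)) a *ℚ gbinom (x +ℚ ℕ→ℚ (b ∸ l)) b
    ≡⟨ cong₂ _*ℚ_ (Tinv-monomial x (a ∸ k) (ℕ.m∸n+n≡m k≤a)) (Tinv-monomial x (b ∸ l) (ℕ.m∸n+n≡m l≤b)) ⟨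
  Tinv a (monomial a k) x *ℚ Tinv b (monomial b l) x ∎
  where
  r : ℕ → ℚ
  r j = ℕ→ℚ (binomOff (a ∸ k + l) j k * binomOff (b ∸ l + k) j l)
  r≡coefficient : ∀ j → r j ≡ coefficient (a ∸ k) k (b ∸ l) l j
  r≡coefficient j = trans (ℕ→ℚ-* (binomOff (a ∸ k + l) j k) (binomOff (b ∸ l + k) j l))
    (cong (λ p → ℕ→ℚ (binomOff p j k) *ℚ ℕ→ℚ (binomOff (b ∸ l + k) j l)) (ℕ.+-comm (a ∸ k) l))
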